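{- It is not the case that HYPERPLANES $\leq$ CYCLIC FLATS; that is, there is no Turing machine running in time polynomial in its input length which, for every matroid $M$, given the list of all hyperplanes of $M$ outputs the list of all cyclic flats of $M$ with their ranks.
   Context: All matroids are finite. A cyclic flat is a flat that is a (possibly empty) union of circuits. A matroid is described to a Turing machine by a list of subsets of its ground set $E$ ($|E| = n$), each subset encoded by its characteristic vector (ranks, where present, in binary), with a reasonable encoding (no padding), so a description listing $i$ subsets has length $\Theta(ni)$. For two description types $I_1, I_2$, $I_1 \leq I_2$ means there is a polynomial-time Turing machine producing the $I_2$-description of $M$ from the $I_1$-description of $M$, for every matroid $M$. -}

module Defs where

open import Data.Nat using (ℕ; zero; suc; _+_; _*_; _^_; _≤_; _<_; ⌊_/2⌋)
open import Data.Bool using (Bool; true; false; if_then_else_)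
open import Data.Fin using (Fin)
import Data.Fin as F
open import Data.Fin.Subset using (Subset; ⊤; ⁅_⁆; _∪_; _∩_; ∣_∣; _⊆_; _⊂_)
import Data.Fin.Subset as S
open import Data.Vec using (Vec; toList)
open import Data.List using (List; []; _∷_; _++_; [_]; map; concatMap; replicate; length)
open import Data.List.Membership.Propositional using () renaming (_∈_ to _∈ₗ_)
open import Data.List.Relation.Unary.Unique.Propositional using (Unique)
open import Data.Maybe using (Maybe; just; nothing)
open import Data.Product using (Σ; ∃; _×_; _,_; proj₁; proj₂)
open import Relation.Binary.PropositionalEquality using (_≡_)
open import Relation.Nullary using (¬_)

record Matroid (n : ℕ) : Set where
  field
    r         : Subset n → ℕ
    r-bound   : ∀ X → r X ≤ ∣ X ∣
    r-mono    : ∀ X Y → X ⊆ Y → r X ≤ r Y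
    r-submod  : ∀ X Y → r (X ∪ Y) + r (X ∩ Y) ≤ r X + r Y

module _ {n : ℕ} (M : Matroid n) where
  open Matroid M

  Flat : Subset n → Set
  Flat X = ∀ e → e S.∉ X → r X < r (X ∪ ⁅ e ⁆)

  Hyperplane : Subset n → Set
  Hyperplane X = Flat X × suc (r X) ≡ r ⊤

  Dependent : Subset n → Set
  Dependent X = r X < ∣ X ∣

  Circuit : Subset n → Set
  Circuit C = Dependent C × (∀ D → D ⊂ C → ¬ Dependent D)

  UnionOfCircuits : Subset n → Set
  UnionOfCircuits X = ∀ e → e S.∈ X → ∃ λ C → Circuit C × C ⊆ X × e S.∈ C

  CyclicFlat : Subset n → Set
  CyclicFlat X = Flat X × UnionOfCircuits X

-- Strings over the I/O alphabet {0, 1, #}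

data Sym : Set where
  b0 b1 sep : Sym

charVec : ∀ {n} → Subset n → List Sym
charVec X = map (λ b → if b then b1 else b0) (toList X)

lsb : ℕ → Sym
lsb zero          = b0
lsb (suc zero)    = b1
lsb (suc (suc k)) = lsb k

-- binary digits, most significant first, of a positive number (with fuel)
binGo : ℕ → ℕ → List Sym
binGo zero    _ = []
binGo (suc f) zero = []
binGo (suc f) (suc k) = binGo f ⌊ suc k /2⌋ ++ [ lsb (suc k) ]

-- standard binary notation without leading zeros; 0 is written "0"
binary : ℕ → List Sym
binary zero    = [ b0 ]
binary (suc k) = binGo (suc k) (suc k)

encodeSubsets : (n : ℕ) → List (Subset n) → List Sym
encodeSubsets n L = replicate n b1 ++ [ sep ] ++ concatMap (λ X → charVec X ++ [ sep ]) L

encodeRanked : ∀ {n} → List (Subset n × ℕ) → List Sym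
encodeRanked = concatMap (λ p → charVec (proj₁ p) ++ [ sep ] ++ binary (proj₂ p) ++ [ sep ])

-- Deterministic single-tape Turing machines.
-- Tape alphabet Fin (4 + extra): 0 = blank, 1,2,3 = the symbols 0,1,#.

data Move : Set where
  moveL moveR stay : Move

record TM : Set where
  field
    states : ℕ
    extra  : ℕ
    start  : Fin states
    -- nothing = halt
    δ      : Fin states → Fin (4 + extra) → Maybe (Fin states × Fin (4 + extra) × Move)

module _ (T : TM) where
  open TM T

  Γ : Set
  Γ = Fin (4 + extra)

  blank : Γ
  blank = F.zero

  embed : Sym → Γ
  embed b0  = F.suc F.zero
  embed b1  = F.suc (F.suc F.zero)
  embed sep = F.suc (F.suc (F.suc F.zero))

  record Config : Set where
    constructor conf
    field
      state : Fin states
      left  : List Γ      -- cells left of the head, nearest first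
      cur   : Γ
      right : List Γ      -- cells right of the head, nearest first

  initConf : List Sym → Config
  initConf []      = conf start [] blank []
  initConf (a ∷ w) = conf start [] (embed a) (map embed w)

  doMove : Move → List Γ → Γ → List Γ → List Γ × Γ × List Γ
  doMove moveL []      c rs = [] , blank , c ∷ rs
  doMove moveL (l ∷ ls) c rs = ls , l , c ∷ rs
  doMove moveR ls c []       = c ∷ ls , blank , []
  doMove moveR ls c (x ∷ rs) = c ∷ ls , x , rs
  doMove stay  ls c rs       = ls , c , rs

  step : Config → Maybe Config
  step (conf q ls c rs) with δ q c
  ... | nothing = nothing
  ... | just (q′ , c′ , m) with doMove m ls c′ rs
  ...   | (ls′ , c″ , rs′) = just (conf q′ ls′ c″ rs′)

  run : ℕ → Config → Config
  run zero    k = k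
  run (suc t) k with step k
  ... | nothing = k
  ... | just k′ = run t k′

  readUntilBlank : List Γ → List Γ
  readUntilBlank []      = []
  readUntilBlank (x ∷ xs) with F._≟_ x blank
  ... | Relation.Nullary.yes _ = []
  ... | Relation.Nullary.no  _ = x ∷ readUntilBlank xs

  HaltsWithin : List Sym → ℕ → List Sym → Set
  HaltsWithin w t v =
    step (run t (initConf w)) ≡ nothing ×
    readUntilBlank (Config.cur (run t (initConf w)) ∷ Config.right (run t (initConf w)))
      ≡ map embed v

ListsExactly : ∀ {n} → (Subset n → Set) → List (Subset n) → Set
ListsExactly P L = Unique L × (∀ X → X ∈ₗ L → P X) × (∀ X → P X → X ∈ₗ L)

CyclicFlatsDescription : ∀ {n} → Matroid n → List Sym → Set
CyclicFlatsDescription {n} M v =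
  Σ (List (Subset n × ℕ)) λ L →
    v ≡ encodeRanked L ×
    (∀ p → p ∈ₗ L → CyclicFlat M (proj₁ p) × Matroid.r M (proj₁ p) ≡ proj₂ p) ×
    (∀ X → CyclicFlat M X → (X , Matroid.r M X) ∈ₗ L)

-- HYPERPLANES ≤ CYCLIC FLATS: a polynomial-time TM (time ≤ c·(1+|w|)^c)
-- that maps every hyperplane description of every matroid to a
-- cyclic-flat description of the same matroid.
HyperplanesToCyclicFlats : Set
HyperplanesToCyclicFlats =
  Σ TM λ T → Σ ℕ λ c →
    ∀ n (M : Matroid n) (L : List (Subset n)) → ListsExactly (Hyperplane M) L →
      Σ (List Sym) λ v →
        HaltsWithin T (encodeSubsets n L) (c * (1 + length (encodeSubsets n L)) ^ c) v ×
        CyclicFlatsDescription M v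

{-# OPTIONS --safe #-}
-- The matroid on 2k elements forming k parallel pairs has only k hyperplanes, so
-- its hyperplane description has length O(k²), but each of its 2ᵏ unions of
-- pairs is a cyclic flat. A Turing machine writes at most one cell per step, so
-- it cannot print a list of 2ᵏ entries in time polynomial in k.
module Submission where

open import Defs
open import Relation.Nullary using (¬_)

open import Algebra.Bundles using (CommutativeMonoid)
import Algebra.Properties.CommutativeSemigroup as CommutativeSemigroup
open import Data.Bool using (true; false; _∨_; T; T?)
open import Data.Bool.Properties using (∨-idem; ∨-commutativeMonoid)
open import Data.Fin using (zero; suc)
open import Data.Fin.Subset using (Subset; ⊤; ⊥; _∪_; _∩_; ∣_∣; _⊆_; _⊂_)
open import Data.Fin.Subset.Properties
  using ( drop-there; drop-∷-⊆; drop-∷-⊂; out⊆; s⊆s; ⊥⊆; ⊂-irref; ⊆-antisym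
        ; ∣⊤∣≡n; ∣⊥∣≡0; ∣p∣≡n⇒p≡⊤; p⊆q⇒∣p∣≤∣q∣; p⊆p∪q; p∩q⊆p; p∩q⊆q; x∈p∩q⁺
        ; ∪-identityʳ)
open import Data.List using (List; []; _∷_; _++_; [_]; map; filter; length; replicate; concatMap)
open import Data.List.Properties using (length-map; length-++; length-++-≤ʳ; length-replicate)
open import Data.List.Membership.Propositional using () renaming (_∈_ to _∈ₗ_)
open import Data.List.Membership.Propositional.Properties using (∈-map⁺; ∈-map⁻; ∈-filter⁺)
open import Data.List.Relation.Unary.Any using (here; there)
import Data.List.Relation.Unary.All as All
import Data.List.Relation.Unary.All.Properties as All
open import Data.List.Relation.Unary.AllPairs using ([]; _∷_)
open import Data.List.Relation.Unary.Unique.Propositional using (Unique)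
import Data.List.Relation.Unary.Unique.Propositional.Properties as Unique
open import Data.Maybe using (nothing; just)
open import Data.Maybe.Relation.Unary.All as MaybeAll using () renaming (All to MaybeAll)
open import Data.Nat using (ℕ; zero; suc; pred; _+_; _*_; _^_; _≤_; _<_; z≤n; s≤s; z<s; s<s; s<s⁻¹)
open import Data.Nat.Properties
open import Data.Nat.Tactic.RingSolver using (solve-∀)
open import Data.Product using (∃; _×_; _,_; proj₁)
open import Data.Vec using ([]; _∷_; here; there; head; tail; toList)
open import Data.Vec.Properties using (∷-injectiveʳ; length-toList)
open import Function using (_∘_)
open import Relation.Binary.PropositionalEquality hiding ([_])
open import Relation.Nullary using (does; yes; no; contradiction)
open import Relation.Unary using (Pred; Decidable)
open import Relation.Unary.Properties using (∁?)

private
  variable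
    k n : ℕ

n<2^n : ∀ n → n < 2 ^ n
n<2^n zero    = z<s
n<2^n (suc n) = begin-strict
  suc n           ≡⟨ +-comm 1 n ⟩
  n + 1           <⟨ +-mono-<-≤ (n<2^n n) (m^n>0 2 n) ⟩
  2 ^ n + 2 ^ n   ≡⟨ cong (2 ^ n +_) (+-identityʳ (2 ^ n)) ⟨
  2 ^ suc n       ∎
  where open ≤-Reasoning

exponential-beats-linear : ∀ a d → ∃ λ m → a + m * d < 2 ^ m
exponential-beats-linear a d = j + j , (begin-strict
  a + (j + j) * d   ≡⟨ regroup a j d ⟩
  a + j * (d + d)   ≤⟨ +-mono-≤ (m≤m+n a (d + d)) (*-monoʳ-≤ j (m≤n+m (d + d) a)) ⟩
  j + j * j         <⟨ s≤s (+-monoʳ-≤ j (*-monoʳ-≤ j (n≤1+n j))) ⟩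
  suc j * suc j     ≤⟨ *-mono-≤ (n<2^n j) (n<2^n j) ⟩
  2 ^ j * 2 ^ j     ≡⟨ ^-distribˡ-+-* 2 j j ⟨
  2 ^ (j + j)       ∎)
  where
  open ≤-Reasoning
  j = a + (d + d)
  regroup : ∀ a j d → a + (j + j) * d ≡ a + j * (d + d)
  regroup = solve-∀

-- Taking k + 1 = 2ᵐ turns the polynomial into a single power of two.
exponential-dominates : ∀ a b d → ∃ λ k → a * (b * suc k) ^ d < 2 ^ k
exponential-dominates a b d with m , linear<2^m ← exponential-beats-linear (a + b * d) d =
  pred (2 ^ m) , (begin-strict
    a * (b * suc (pred (2 ^ m))) ^ d ≡⟨ cong (λ x → a * (b * x) ^ d) (suc-pred (2 ^ m) {{m^n≢0 2 m}}) ⟩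
    a * (b * 2 ^ m) ^ d              ≤⟨ *-monoʳ-≤ a (^-monoˡ-≤ d (*-monoˡ-≤ (2 ^ m) (<⇒≤ (n<2^n b)))) ⟩
    a * (2 ^ b * 2 ^ m) ^ d          ≡⟨ cong (λ x → a * x ^ d) (^-distribˡ-+-* 2 b m) ⟨
    a * (2 ^ (b + m)) ^ d            ≡⟨ cong (a *_) (^-*-assoc 2 (b + m) d) ⟩
    a * 2 ^ ((b + m) * d)            <⟨ *-monoˡ-< (2 ^ ((b + m) * d)) {{m^n≢0 2 ((b + m) * d)}} (n<2^n a) ⟩
    2 ^ a * 2 ^ ((b + m) * d)        ≡⟨ ^-distribˡ-+-* 2 a ((b + m) * d) ⟨
    2 ^ (a + (b + m) * d)            ≤⟨ ^-monoʳ-≤ 2 exponent-bound ⟩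
    2 ^ pred (2 ^ m)                 ∎)
  where
  open ≤-Reasoning
  regroup : ∀ a b m d → a + (b + m) * d ≡ a + b * d + m * d
  regroup = solve-∀
  exponent-bound : a + (b + m) * d ≤ pred (2 ^ m)
  exponent-bound = <⇒≤pred (subst (_< 2 ^ m) (sym (regroup a b m d)) linear<2^m)

polynomial-absorbs-linear : ∀ c N → suc (c * suc N ^ c + N) ≤ suc c * suc N ^ suc c
polynomial-absorbs-linear c N = begin
  suc (c * P + N)      ≡⟨ +-suc (c * P) N ⟨
  c * P + X            ≤⟨ +-mono-≤ (*-monoʳ-≤ c (m≤n*m P X)) (m≤m*n X P {{m^n≢0 X c}}) ⟩
  c * (X * P) + X * P  ≡⟨ +-comm (c * (X * P)) (X * P) ⟩
  suc c * (X * P)      ∎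
  where
  open ≤-Reasoning
  X = suc N
  P = X ^ c

∣p∪q∣+∣p∩q∣≡∣p∣+∣q∣ : ∀ (p q : Subset n) → ∣ p ∪ q ∣ + ∣ p ∩ q ∣ ≡ ∣ p ∣ + ∣ q ∣
∣p∪q∣+∣p∩q∣≡∣p∣+∣q∣ []          []          = refl
∣p∪q∣+∣p∩q∣≡∣p∣+∣q∣ (true ∷ p)  (true ∷ q)  = cong suc (begin
  ∣ p ∪ q ∣ + suc ∣ p ∩ q ∣ ≡⟨ +-suc ∣ p ∪ q ∣ ∣ p ∩ q ∣ ⟩
  suc (∣ p ∪ q ∣ + ∣ p ∩ q ∣) ≡⟨ cong suc (∣p∪q∣+∣p∩q∣≡∣p∣+∣q∣ p q) ⟩
  suc (∣ p ∣ + ∣ q ∣)       ≡⟨ +-suc ∣ p ∣ ∣ q ∣ ⟨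
  ∣ p ∣ + suc ∣ q ∣         ∎)
  where open ≡-Reasoning
∣p∪q∣+∣p∩q∣≡∣p∣+∣q∣ (true ∷ p)  (false ∷ q) = cong suc (∣p∪q∣+∣p∩q∣≡∣p∣+∣q∣ p q)
∣p∪q∣+∣p∩q∣≡∣p∣+∣q∣ (false ∷ p) (true ∷ q)  =
  trans (cong suc (∣p∪q∣+∣p∩q∣≡∣p∣+∣q∣ p q)) (sym (+-suc ∣ p ∣ ∣ q ∣))
∣p∪q∣+∣p∩q∣≡∣p∣+∣q∣ (false ∷ p) (false ∷ q) = ∣p∪q∣+∣p∩q∣≡∣p∣+∣q∣ p q

p⊆q⇒p∪q≡q : ∀ {p q : Subset n} → p ⊆ q → p ∪ q ≡ q
p⊆q⇒p∪q≡q {p = []}      {[]}    _   = refl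
p⊆q⇒p∪q≡q {p = true ∷ p} {_ ∷ q} p⊆q with p⊆q here
... | here = cong (true ∷_) (p⊆q⇒p∪q≡q (drop-∷-⊆ p⊆q))
p⊆q⇒p∪q≡q {p = false ∷ p} {x ∷ q} p⊆q = cong (x ∷_) (p⊆q⇒p∪q≡q (drop-∷-⊆ p⊆q))

length-filter+length-filter-∁ : ∀ {a p} {A : Set a} {P : Pred A p} (P? : Decidable P) xs →
                                length (filter P? xs) + length (filter (∁? P?) xs) ≡ length xs
length-filter+length-filter-∁ P? []       = refl
length-filter+length-filter-∁ P? (x ∷ xs) with does (P? x)
... | true  = cong suc (length-filter+length-filter-∁ P? xs)
... | false = trans (+-suc _ _) (cong suc (length-filter+length-filter-∁ P? xs))

2^n≤length : (L : List (Subset n)) → (∀ S → S ∈ₗ L) → 2 ^ n ≤ length L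
2^n≤length {zero}  []      covers = contradiction (covers []) λ ()
2^n≤length {zero}  (_ ∷ _) _      = s≤s z≤n
2^n≤length {suc n} L       covers = begin
  2 ^ suc n
    ≡⟨ cong (2 ^ n +_) (+-identityʳ (2 ^ n)) ⟩
  2 ^ n + 2 ^ n
    ≤⟨ +-mono-≤ (2^n≤length (tailsWith startsTrue?) (λ S → tail∈ startsTrue? (covers (true ∷ S)) _))
                (2^n≤length (tailsWith (∁? startsTrue?)) (λ S → tail∈ (∁? startsTrue?) (covers (false ∷ S)) λ ())) ⟩
  length (tailsWith startsTrue?) + length (tailsWith (∁? startsTrue?))
    ≡⟨ cong₂ _+_ (length-map tail (filter startsTrue? L)) (length-map tail (filter (∁? startsTrue?) L)) ⟩
  length (filter startsTrue? L) + length (filter (∁? startsTrue?) L)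
    ≡⟨ length-filter+length-filter-∁ startsTrue? L ⟩
  length L ∎
  where
  open ≤-Reasoning
  startsTrue? : Decidable (T ∘ head)
  startsTrue? = T? ∘ head
  tailsWith : {P : Pred (Subset (suc n)) _} → Decidable P → List (Subset n)
  tailsWith P? = map tail (filter P? L)
  tail∈ : ∀ {P : Pred (Subset (suc n)) _} (P? : Decidable P) {S} → S ∈ₗ L → P S → tail S ∈ₗ tailsWith P?
  tail∈ P? S∈L PS = ∈-map⁺ tail (∈-filter⁺ P? S∈L PS)

twice : ℕ → ℕ
twice zero    = zero
twice (suc k) = suc (suc (twice k))

twice≡+ : ∀ k → twice k ≡ k + k
twice≡+ zero    = refl
twice≡+ (suc k) = cong suc (trans (cong suc (twice≡+ k)) (sym (+-suc k k)))

-- Elements 2i and 2i+1 of Fin (twice k) form the i-th pair.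
double : Subset k → Subset (twice k)
double []      = []
double (s ∷ S) = s ∷ s ∷ double S

pairsMet : Subset (twice k) → Subset k
pairsMet {zero}  []          = []
pairsMet {suc k} (a ∷ b ∷ X) = (a ∨ b) ∷ pairsMet X

pairsMet-double : ∀ (S : Subset k) → pairsMet (double S) ≡ S
pairsMet-double []      = refl
pairsMet-double (s ∷ S) = cong₂ _∷_ (∨-idem s) (pairsMet-double S)

double-injective : ∀ {S S′ : Subset k} → double S ≡ double S′ → S ≡ S′
double-injective {S = S} {S′} eq =
  trans (sym (pairsMet-double S)) (trans (cong pairsMet eq) (pairsMet-double S′))

∣pairsMet-⊤∣ : ∀ k → ∣ pairsMet {k} ⊤ ∣ ≡ k
∣pairsMet-⊤∣ zero    = refl
∣pairsMet-⊤∣ (suc k) = cong suc (∣pairsMet-⊤∣ k)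

∣pairsMet-⊥∣ : ∀ k → ∣ pairsMet {k} ⊥ ∣ ≡ 0
∣pairsMet-⊥∣ zero    = refl
∣pairsMet-⊥∣ (suc k) = ∣pairsMet-⊥∣ k

∣pairsMet-∪⊥∣ : ∀ (X : Subset (twice k)) → ∣ pairsMet (X ∪ ⊥) ∣ ≡ ∣ pairsMet X ∣
∣pairsMet-∪⊥∣ X = cong (∣_∣ ∘ pairsMet) (∪-identityʳ X)

pairsMet-∪ : ∀ (X Y : Subset (twice k)) → pairsMet (X ∪ Y) ≡ pairsMet X ∪ pairsMet Y
pairsMet-∪ {zero}  []          []          = refl
pairsMet-∪ {suc k} (a ∷ b ∷ X) (c ∷ d ∷ Y) = cong₂ _∷_ (∨-interchange a c b d) (pairsMet-∪ X Y)
  where open CommutativeSemigroup (CommutativeMonoid.commutativeSemigroup ∨-commutativeMonoid)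
          renaming (interchange to ∨-interchange)

pairsMet-mono : ∀ {X Y : Subset (twice k)} → X ⊆ Y → pairsMet X ⊆ pairsMet Y
pairsMet-mono {X = X} {Y} X⊆Y =
  subst (pairsMet X ⊆_) (trans (sym (pairsMet-∪ X Y)) (cong pairsMet (p⊆q⇒p∪q≡q X⊆Y))) (p⊆p∪q (pairsMet Y))

∣pairsMet∣≤∣∣ : ∀ (X : Subset (twice k)) → ∣ pairsMet X ∣ ≤ ∣ X ∣
∣pairsMet∣≤∣∣ {zero}  []                  = z≤n
∣pairsMet∣≤∣∣ {suc k} (false ∷ false ∷ X) = ∣pairsMet∣≤∣∣ X
∣pairsMet∣≤∣∣ {suc k} (false ∷ true ∷ X)  = s≤s (∣pairsMet∣≤∣∣ X)
∣pairsMet∣≤∣∣ {suc k} (true ∷ false ∷ X)  = s≤s (∣pairsMet∣≤∣∣ X)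
∣pairsMet∣≤∣∣ {suc k} (true ∷ true ∷ X)   = s≤s (m≤n⇒m≤1+n (∣pairsMet∣≤∣∣ X))

pairsMet-submodular : ∀ (X Y : Subset (twice k)) →
                      ∣ pairsMet (X ∪ Y) ∣ + ∣ pairsMet (X ∩ Y) ∣ ≤ ∣ pairsMet X ∣ + ∣ pairsMet Y ∣
pairsMet-submodular X Y = begin
  ∣ pairsMet (X ∪ Y) ∣ + ∣ pairsMet (X ∩ Y) ∣ ≡⟨ cong (λ Z → ∣ Z ∣ + ∣ pairsMet (X ∩ Y) ∣) (pairsMet-∪ X Y) ⟩
  ∣ A ∪ B ∣ + ∣ pairsMet (X ∩ Y) ∣            ≤⟨ +-monoʳ-≤ ∣ A ∪ B ∣ (p⊆q⇒∣p∣≤∣q∣ pairsMet-∩) ⟩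
  ∣ A ∪ B ∣ + ∣ A ∩ B ∣                       ≡⟨ ∣p∪q∣+∣p∩q∣≡∣p∣+∣q∣ A B ⟩
  ∣ A ∣ + ∣ B ∣                               ∎
  where
  open ≤-Reasoning
  A = pairsMet X
  B = pairsMet Y
  pairsMet-∩ : pairsMet (X ∩ Y) ⊆ A ∩ B
  pairsMet-∩ i∈ = x∈p∩q⁺ (pairsMet-mono (p∩q⊆p X Y) i∈ , pairsMet-mono (p∩q⊆q X Y) i∈)

parallelPairs : ∀ k → Matroid (twice k)
parallelPairs k = record
  { r        = ∣_∣ ∘ pairsMet
  ; r-bound  = ∣pairsMet∣≤∣∣
  ; r-mono   = λ _ _ X⊆Y → p⊆q⇒∣p∣≤∣q∣ (pairsMet-mono X⊆Y)
  ; r-submod = pairsMet-submodular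
  }

double-flat : ∀ (S : Subset k) → Flat (parallelPairs k) (double S)
double-flat (true ∷ S)  zero          e∉ = contradiction here e∉
double-flat (true ∷ S)  (suc zero)    e∉ = contradiction (there here) e∉
double-flat (false ∷ S) zero          _  = s≤s (≤-reflexive (sym (∣pairsMet-∪⊥∣ (double S))))
double-flat (false ∷ S) (suc zero)    _  = s≤s (≤-reflexive (sym (∣pairsMet-∪⊥∣ (double S))))
double-flat (false ∷ S) (suc (suc e)) e∉ = double-flat S e (λ e∈ → e∉ (there (there e∈)))
double-flat (true ∷ S)  (suc (suc e)) e∉ = s<s (double-flat S e (λ e∈ → e∉ (there (there e∈))))

flat-dropPair : ∀ a (X : Subset (twice k)) → Flat (parallelPairs (suc k)) (a ∷ a ∷ X) → Flat (parallelPairs k) X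
flat-dropPair false X flat e e∉ = flat (suc (suc e)) (e∉ ∘ drop-there ∘ drop-there)
flat-dropPair true  X flat e e∉ = s<s⁻¹ (flat (suc (suc e)) (e∉ ∘ drop-there ∘ drop-there))

flat⇒double : ∀ (X : Subset (twice k)) → Flat (parallelPairs k) X → X ≡ double (pairsMet X)
flat⇒double {zero}  []                  _    = refl
flat⇒double {suc k} (false ∷ false ∷ X) flat =
  cong (λ Y → false ∷ false ∷ Y) (flat⇒double X (flat-dropPair false X flat))
flat⇒double {suc k} (true ∷ true ∷ X)   flat =
  cong (λ Y → true ∷ true ∷ Y) (flat⇒double X (flat-dropPair true X flat))
flat⇒double {suc k} (true ∷ false ∷ X)  flat =
  contradiction (s<s⁻¹ (flat (suc zero) λ { (there ()) })) (<-irrefl (sym (∣pairsMet-∪⊥∣ X)))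
flat⇒double {suc k} (false ∷ true ∷ X)  flat =
  contradiction (s<s⁻¹ (flat zero λ ())) (<-irrefl (sym (∣pairsMet-∪⊥∣ X)))

coatoms : ∀ k → List (Subset k)
coatoms zero    = []
coatoms (suc k) = (false ∷ ⊤) ∷ map (true ∷_) (coatoms k)

length-coatoms : ∀ k → length (coatoms k) ≡ k
length-coatoms zero    = refl
length-coatoms (suc k) = cong suc (trans (length-map (true ∷_) (coatoms k)) (length-coatoms k))

∈-coatoms⁻ : ∀ {S : Subset k} → S ∈ₗ coatoms k → suc ∣ S ∣ ≡ k
∈-coatoms⁻ {suc k} (here refl) = cong suc (∣⊤∣≡n k)
∈-coatoms⁻ {suc k} (there S∈) with ∈-map⁻ (true ∷_) S∈
... | _ , S′∈ , refl = cong suc (∈-coatoms⁻ S′∈)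

∈-coatoms⁺ : ∀ k (S : Subset k) → suc ∣ S ∣ ≡ k → S ∈ₗ coatoms k
∈-coatoms⁺ (suc k) (true ∷ S)  eq = there (∈-map⁺ (true ∷_) (∈-coatoms⁺ k S (suc-injective eq)))
∈-coatoms⁺ (suc k) (false ∷ S) eq = here (cong (false ∷_) (∣p∣≡n⇒p≡⊤ (suc-injective eq)))

coatoms-unique : ∀ k → Unique (coatoms k)
coatoms-unique zero    = []
coatoms-unique (suc k) =
  All.map⁺ (All.universal (λ _ ()) (coatoms k)) ∷ Unique.map⁺ ∷-injectiveʳ (coatoms-unique k)

hyperplanes : ∀ k → List (Subset (twice k))
hyperplanes k = map double (coatoms k)

hyperplanes-listed : ∀ k → ListsExactly (Hyperplane (parallelPairs k)) (hyperplanes k)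
hyperplanes-listed k = Unique.map⁺ double-injective (coatoms-unique k) , listed⇒hyperplane , hyperplane⇒listed
  where
  listed⇒hyperplane : ∀ X → X ∈ₗ hyperplanes k → Hyperplane (parallelPairs k) X
  listed⇒hyperplane X X∈ with ∈-map⁻ double X∈
  ... | S , S∈ , refl = double-flat S , (begin
    suc ∣ pairsMet (double S) ∣ ≡⟨ cong (suc ∘ ∣_∣) (pairsMet-double S) ⟩
    suc ∣ S ∣                   ≡⟨ ∈-coatoms⁻ S∈ ⟩
    k                           ≡⟨ ∣pairsMet-⊤∣ k ⟨
    ∣ pairsMet {k} ⊤ ∣          ∎)
    where open ≡-Reasoning
  hyperplane⇒listed : ∀ X → Hyperplane (parallelPairs k) X → X ∈ₗ hyperplanes k
  hyperplane⇒listed X (flat , rank) =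
    subst (_∈ₗ hyperplanes k) (sym (flat⇒double X flat))
          (∈-map⁺ double (∈-coatoms⁺ k (pairsMet X) (trans rank (∣pairsMet-⊤∣ k))))

pair-circuit : Circuit (parallelPairs (suc k)) (true ∷ true ∷ ⊥)
pair-circuit {k} = s<s (subst (_< suc ∣ ⊥ {twice k} ∣) (sym (∣pairsMet-⊥∣ k)) z<s) , independent
  where
  rest⊆⊥ : ∀ {d₁ d₂} {D : Subset (twice k)} → d₁ ∷ d₂ ∷ D ⊂ true ∷ true ∷ ⊥ → D ⊆ ⊥
  rest⊆⊥ (D⊆ , _) = drop-∷-⊆ (drop-∷-⊆ D⊆)
  ∣rest∣≤0 : ∀ {d₁ d₂} {D : Subset (twice k)} → d₁ ∷ d₂ ∷ D ⊂ true ∷ true ∷ ⊥ → ∣ D ∣ ≤ 0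
  ∣rest∣≤0 D⊂ = ≤-trans (p⊆q⇒∣p∣≤∣q∣ (rest⊆⊥ D⊂)) (≤-reflexive (∣⊥∣≡0 (twice k)))
  independent : ∀ D → D ⊂ true ∷ true ∷ ⊥ → ¬ Dependent (parallelPairs (suc k)) D
  independent (true  ∷ true  ∷ D) D⊂ _   = ⊂-irref (cong (λ Y → true ∷ true ∷ Y) (⊆-antisym (rest⊆⊥ D⊂) ⊥⊆)) D⊂
  independent (true  ∷ false ∷ D) D⊂ dep = n≮0 (<-≤-trans (s<s⁻¹ dep) (∣rest∣≤0 D⊂))
  independent (false ∷ true  ∷ D) D⊂ dep = n≮0 (<-≤-trans (s<s⁻¹ dep) (∣rest∣≤0 D⊂))
  independent (false ∷ false ∷ D) D⊂ dep = n≮0 (<-≤-trans dep (∣rest∣≤0 D⊂))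

circuit-∷ : ∀ {C : Subset (twice k)} → Circuit (parallelPairs k) C →
            Circuit (parallelPairs (suc k)) (false ∷ false ∷ C)
circuit-∷ {k} {C} (dependent , minimal) = dependent , independent
  where
  independent : ∀ D → D ⊂ false ∷ false ∷ C → ¬ Dependent (parallelPairs (suc k)) D
  independent (true ∷ _)          (D⊆ , _) = contradiction (D⊆ here) λ ()
  independent (false ∷ true ∷ _)  (D⊆ , _) = contradiction (D⊆ (there here)) λ { (there ()) }
  independent (false ∷ false ∷ D) D⊂       = minimal D (drop-∷-⊂ (drop-∷-⊂ D⊂))

double-unionOfCircuits : ∀ (S : Subset k) → UnionOfCircuits (parallelPairs k) (double S)
double-unionOfCircuits (true ∷ S) zero       here         = _ , pair-circuit , s⊆s (s⊆s ⊥⊆) , here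
double-unionOfCircuits (true ∷ S) (suc zero) (there here) = _ , pair-circuit , s⊆s (s⊆s ⊥⊆) , there here
double-unionOfCircuits (_ ∷ S) (suc (suc e)) (there (there e∈)) with double-unionOfCircuits S e e∈
... | C , circuit , C⊆ , e∈C = false ∷ false ∷ C , circuit-∷ circuit , out⊆ (out⊆ C⊆) , there (there e∈C)

double-cyclicFlat : ∀ (S : Subset k) → CyclicFlat (parallelPairs k) (double S)
double-cyclicFlat S = double-flat S , double-unionOfCircuits S

length-charVec : ∀ (X : Subset n) → length (charVec X) ≡ n
length-charVec X = trans (length-map _ (toList X)) (length-toList X)

length-encodeSubsets : ∀ n (L : List (Subset n)) → length (encodeSubsets n L) ≡ n + suc (length L * suc n)
length-encodeSubsets n L = begin
  length (replicate n b1 ++ sep ∷ blocks L)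
    ≡⟨ length-++ (replicate n b1) ⟩
  length (replicate n b1) + suc (length (blocks L))
    ≡⟨ cong₂ (λ a b → a + suc b) (length-replicate n) (length-blocks L) ⟩
  n + suc (length L * suc n) ∎
  where
  open ≡-Reasoning
  blocks : List (Subset n) → List Sym
  blocks = concatMap (λ X → charVec X ++ [ sep ])
  length-blocks : ∀ L → length (blocks L) ≡ length L * suc n
  length-blocks []      = refl
  length-blocks (X ∷ L) = begin
    length ((charVec X ++ [ sep ]) ++ blocks L)        ≡⟨ length-++ (charVec X ++ [ sep ]) ⟩
    length (charVec X ++ [ sep ]) + length (blocks L)  ≡⟨ cong₂ _+_ (length-++ (charVec X)) (length-blocks L) ⟩
    (length (charVec X) + 1) + length L * suc n        ≡⟨ cong (λ m → m + 1 + length L * suc n) (length-charVec X) ⟩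
    (n + 1) + length L * suc n                         ≡⟨ cong (_+ length L * suc n) (+-comm n 1) ⟩
    suc n + length L * suc n                           ∎

length≤length-encodeRanked : ∀ (L : List (Subset n × ℕ)) → length L ≤ length (encodeRanked L)
length≤length-encodeRanked []            = z≤n
length≤length-encodeRanked ((X , r) ∷ L) = begin
  1 + length L                             ≤⟨ +-mono-≤ (≤-trans (s≤s z≤n) (length-++-≤ʳ (sep ∷ _) {charVec X}))
                                                       (length≤length-encodeRanked L) ⟩
  length block + length (encodeRanked L)   ≡⟨ length-++ block ⟨
  length (block ++ encodeRanked L)         ∎
  where
  open ≤-Reasoning
  block = charVec X ++ [ sep ] ++ binary r ++ [ sep ]

hyperplanes-input-bound : ∀ k → suc (length (encodeSubsets (twice k) (hyperplanes k))) ≤ (2 * suc k) ^ 2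
hyperplanes-input-bound k = begin
  suc (length (encodeSubsets (twice k) (hyperplanes k)))
    ≡⟨ cong suc (length-encodeSubsets (twice k) (hyperplanes k)) ⟩
  suc (twice k + suc (length (hyperplanes k) * suc (twice k)))
    ≡⟨ cong₂ (λ t h → suc (t + suc (h * suc t))) (twice≡+ k) (trans (length-map double (coatoms k)) (length-coatoms k)) ⟩
  suc (k + k + suc (k * suc (k + k)))
    ≤⟨ m≤m+n _ (2 * (k * k) + 5 * k + 2) ⟩
  suc (k + k + suc (k * suc (k + k))) + (2 * (k * k) + 5 * k + 2)
    ≡⟨ expand k ⟩
  (2 * suc k) ^ 2 ∎
  where
  open ≤-Reasoning
  expand : ∀ k → suc (k + k + suc (k * suc (k + k))) + (2 * (k * k) + 5 * k + 2) ≡ 2 * suc k * (2 * suc k * 1)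
  expand = solve-∀

module _ (T : TM) where

  tapeLength : Config T → ℕ
  tapeLength (conf _ ls _ rs) = length ls + length rs

  doMove-tapeLength : ∀ m ls c rs → let (ls′ , _ , rs′) = doMove T m ls c rs in
                      length ls′ + length rs′ ≤ suc (length ls + length rs)
  doMove-tapeLength moveL []       c rs       = ≤-refl
  doMove-tapeLength moveL (l ∷ ls) c rs       = m≤n⇒m≤1+n (≤-reflexive (+-suc (length ls) (length rs)))
  doMove-tapeLength moveR ls       c []       = ≤-refl
  doMove-tapeLength moveR ls       c (x ∷ rs) = s≤s (+-monoʳ-≤ (length ls) (n≤1+n (length rs)))
  doMove-tapeLength stay  ls       c rs       = n≤1+n _

  step-tapeLength : ∀ κ → MaybeAll (λ κ′ → tapeLength κ′ ≤ suc (tapeLength κ)) (step T κ)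
  step-tapeLength (conf q ls c rs) with TM.δ T q c
  ... | nothing            = MaybeAll.nothing
  ... | just (_ , c′ , m) with doMove T m ls c′ rs | doMove-tapeLength m ls c′ rs
  ...   | _ , _ , _ | grows = MaybeAll.just grows

  run-tapeLength : ∀ t κ → tapeLength (run T t κ) ≤ t + tapeLength κ
  run-tapeLength zero    κ = ≤-refl
  run-tapeLength (suc t) κ with step T κ | step-tapeLength κ
  ... | nothing | _                 = m≤n+m (tapeLength κ) (suc t)
  ... | just κ′ | MaybeAll.just grows = begin
    tapeLength (run T t κ′) ≤⟨ run-tapeLength t κ′ ⟩
    t + tapeLength κ′       ≤⟨ +-monoʳ-≤ t grows ⟩
    t + suc (tapeLength κ)  ≡⟨ +-suc t (tapeLength κ) ⟩
    suc t + tapeLength κ    ∎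
    where open ≤-Reasoning

  initConf-tapeLength : ∀ w → tapeLength (initConf T w) ≤ length w
  initConf-tapeLength []      = z≤n
  initConf-tapeLength (a ∷ w) = m≤n⇒m≤1+n (≤-reflexive (length-map (embed T) w))

  length-readUntilBlank : ∀ xs → length (readUntilBlank T xs) ≤ length xs
  length-readUntilBlank []       = z≤n
  length-readUntilBlank (x ∷ xs) with Data.Fin._≟_ x (blank T)
  ... | yes _ = z≤n
  ... | no  _ = s≤s (length-readUntilBlank xs)

  output-length : ∀ w t {v} → HaltsWithin T w t v → length v ≤ suc (t + length w)
  output-length w t {v} (_ , output) = begin
    length v                            ≡⟨ length-map (embed T) v ⟨
    length (map (embed T) v)            ≡⟨ cong length output ⟨
    length (readUntilBlank T (cur ∷ right))
                                        ≤⟨ length-readUntilBlank (cur ∷ right) ⟩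
    suc (length right)                  ≤⟨ s≤s (m≤n+m _ (length (Config.left κ))) ⟩
    suc (tapeLength κ)                  ≤⟨ s≤s (run-tapeLength t (initConf T w)) ⟩
    suc (t + tapeLength (initConf T w)) ≤⟨ s≤s (+-monoʳ-≤ t (initConf-tapeLength w)) ⟩
    suc (t + length w)                  ∎
    where
    open ≤-Reasoning
    κ = run T t (initConf T w)
    open Config κ using (cur; right)

cyclicFlatsDescription-length : ∀ {v} → CyclicFlatsDescription (parallelPairs k) v → 2 ^ k ≤ length v
cyclicFlatsDescription-length {k} (L , refl , _ , complete) = begin
  2 ^ k                                ≤⟨ 2^n≤length (map (pairsMet ∘ proj₁) L) covers ⟩
  length (map (pairsMet ∘ proj₁) L)    ≡⟨ length-map (pairsMet ∘ proj₁) L ⟩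
  length L                             ≤⟨ length≤length-encodeRanked L ⟩
  length (encodeRanked L)              ∎
  where
  open ≤-Reasoning
  covers : ∀ S → S ∈ₗ map (pairsMet ∘ proj₁) L
  covers S = subst (_∈ₗ map (pairsMet ∘ proj₁) L) (pairsMet-double S)
                   (∈-map⁺ (pairsMet ∘ proj₁) (complete (double S) (double-cyclicFlat S)))

parallelPairs-too-slow : ∀ T c k → suc c * (2 * suc k) ^ (2 * suc c) < 2 ^ k →
                         let w = encodeSubsets (twice k) (hyperplanes k) in
                         ¬ ∃ λ v → HaltsWithin T w (c * (1 + length w) ^ c) v × CyclicFlatsDescription (parallelPairs k) v
parallelPairs-too-slow T c k poly<2^k (v , halts , description) = <-irrefl refl (begin-strict
  2 ^ k                                 ≤⟨ cyclicFlatsDescription-length description ⟩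
  length v                              ≤⟨ output-length T w (c * suc N ^ c) halts ⟩
  suc (c * suc N ^ c + N)               ≤⟨ polynomial-absorbs-linear c N ⟩
  suc c * suc N ^ suc c                 ≤⟨ *-monoʳ-≤ (suc c) (^-monoˡ-≤ (suc c) (hyperplanes-input-bound k)) ⟩
  suc c * ((2 * suc k) ^ 2) ^ suc c     ≡⟨ cong (suc c *_) (^-*-assoc (2 * suc k) 2 (suc c)) ⟩
  suc c * (2 * suc k) ^ (2 * suc c)     <⟨ poly<2^k ⟩
  2 ^ k                                 ∎)
  where
  open ≤-Reasoning
  w = encodeSubsets (twice k) (hyperplanes k)
  N = length w

lemma15 : ¬ HyperplanesToCyclicFlats
lemma15 (T , c , translate) =
  let k , poly<2^k = exponential-dominates (suc c) 2 (2 * suc c)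
  in parallelPairs-too-slow T c k poly<2^k (translate (twice k) (parallelPairs k) (hyperplanes k) (hyperplanes-listed k))
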